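{- Let $K$ be a field of characteristic $0$, $e\ge2$, $A,B,C\in M_e(K)$ and $d_1,d_2\in(\mathbb{Z}/e\mathbb{Z})^\times$. Then \[ A\overset{d_1}{\ast}(B\overset{d_2}{\ast}C)=(A\overset{ -d_2^{ -1}d_1}{\ast}B)\overset{d_2}{\ast}C. \] In particular $A\overset{d_1}{\ast}(B\overset{ -1}{\ast}C)=(A\overset{d_1}{\ast}B)\overset{ -1}{\ast}C$, and hence the $(-1)$-composition $\overset{ -1}{\ast}$ is associative.
   Context: For $A=[a_{i,j}]$, $B=[b_{i,j}]\in M_e(K)$ (indices read modulo $e$) and $d\in\mathbb{Z}/e\mathbb{Z}\setminus\{0\}$, the $d$-composition is $A\overset{d}{\ast}B=\big[\sum_{s=0}^{e-1}\sum_{t=0}^{e-1}a_{s,t}b_{ds+i,dt+j}\big]_{0\le i,j\le e-1}$. -}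

module Defs where

open import Level using (Level; _⊔_; suc)
open import Data.Nat as ℕ using (ℕ; NonZero)
open import Data.Nat.DivMod using (_mod_)
open import Data.Fin using (Fin; toℕ)
open import Data.Product using (Σ; ∃)
open import Relation.Binary.PropositionalEquality using (_≡_)
open import Relation.Nullary using (¬_)
open import Algebra.Bundles using (CommutativeRing)
import Algebra.Definitions.RawMonoid as RawMonoidDefs

record Field (c ℓ : Level) : Set (suc (c ⊔ ℓ)) where
  field
    commutativeRing : CommutativeRing c ℓ
  open CommutativeRing commutativeRing public
  field
    1≉0     : ¬ (1# ≈ 0#)
    inverse : ∀ x → ¬ (x ≈ 0#) → Σ Carrier λ y → x * y ≈ 1#

module _ {c ℓ} (K : Field c ℓ) where
  open Field K
  open RawMonoidDefs +-rawMonoid using (_×_)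

  CharZero : Set ℓ
  CharZero = ∀ (n : ℕ) → ¬ ((ℕ.suc n × 1#) ≈ 0#)

-- ℤ/eℤ, represented by Fin e (canonical representatives 0..e-1).

module _ (e : ℕ) .{{_ : NonZero e}} where

  ZMod : Set
  ZMod = Fin e

  mulZ : ZMod → ZMod → ZMod
  mulZ a b = (toℕ a ℕ.* toℕ b) mod e

  negZ : ZMod → ZMod
  negZ a = (e ℕ.∸ toℕ a) mod e

  oneZ : ZMod
  oneZ = 1 mod e

  minusOneZ : ZMod
  minusOneZ = negZ oneZ

  record UnitZ : Set where
    constructor unitZ
    field
      val     : ZMod
      inv     : ZMod
      val*inv : mulZ val inv ≡ oneZ

-- Matrices in M_e(K), indexed by Fin e (indices read modulo e),
-- the d-composition, and entrywise equality.

module _ {c ℓ} (K : Field c ℓ) where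
  open Field K
  open RawMonoidDefs +-rawMonoid using (sum)

  Mat : ℕ → Set c
  Mat e = Fin e → Fin e → Carrier

  compose : ∀ {e} .{{_ : NonZero e}} → Mat e → ZMod e → Mat e → Mat e
  compose {e} A d B i j =
    sum λ s → sum λ t →
      A s t * B ((toℕ d ℕ.* toℕ s ℕ.+ toℕ i) mod e)
                ((toℕ d ℕ.* toℕ t ℕ.+ toℕ j) mod e)

  _≋_ : ∀ {e} → Mat e → Mat e → Set ℓ
  A ≋ B = ∀ i j → A i j ≈ B i j

{-# OPTIONS --safe #-}
-- Writing a matrix entry of A ∗[d] B as Σ_{s,t} a_{s,t} b_{ds+i, dt+j}, the left-hand side is a
-- fourfold sum Σ_{s,t,u,v} a_{s,t} b_{u,v} c_{d₂u + d₁s + i, d₂v + d₁t + j}.  Shifting u ↦ u + ds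
-- and v ↦ v + dt turns the index of c into d₂u + (d₂d + d₁)s + i, so as soon as d₂d + d₁ ≡ 0
-- (mod e) the dependence of c on s, t disappears and the sum regroups as the right-hand side.
-- For d = −d₂⁻¹d₁ this is the first claim; for d₂ = −1 and d = d₁ it is the other two.
module Submission where

open import Level using (0ℓ)
open import Defs
open import Data.Nat using (ℕ; NonZero; _≤_)
open import Data.Fin using (Fin; toℕ)
open import Data.Fin.Properties using (toℕ-fromℕ<; toℕ-injective; toℕ<n)
open import Data.Fin.Permutation using (Permutation; permutation; _⟨$⟩ʳ_)
open import Data.Product using (_×_; _,_)
open import Algebra.Bundles using (Semiring)
import Algebra.Properties.Semiring.Sum as SemiringSum
import Relation.Binary.Construct.On as On
import Relation.Binary.PropositionalEquality as ≡
open ≡ using (_≡_)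
import Relation.Binary.Reasoning.Setoid as SetoidReasoning
open import Relation.Binary.Bundles using (Setoid)

module ModularArithmetic (e : ℕ) .{{_ : NonZero e}} where

  open import Data.Nat using (_+_; _*_; _∸_)
  open import Data.Nat.Properties using (+-comm; +-assoc; *-comm; *-assoc; *-identityˡ; *-identityʳ; *-zeroʳ; *-distribˡ-+; m∸n+n≡m)
  open import Data.Nat.DivMod using (_%_; _mod_; m%n<n; m%n≤n; m%n%n≡m%n; m*n%n≡0; n%n≡0; m<n⇒m%n≡m; %-distribˡ-+; %-distribˡ-*)
  open import Data.Nat.Tactic.RingSolver using (solve-∀)

  ≡ₘ-setoid : Setoid 0ℓ 0ℓ
  ≡ₘ-setoid = On.setoid (≡.setoid ℕ) (_% e)

  open SetoidReasoning ≡ₘ-setoid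
  open Setoid ≡ₘ-setoid public using () renaming (_≈_ to _≡ₘ_)
  open Setoid ≡ₘ-setoid using (refl; trans; reflexive)

  %-≡ₘ : ∀ m → m % e ≡ₘ m
  %-≡ₘ m = m%n%n≡m%n m e

  +-congₘ : ∀ {a a′ b b′} → a ≡ₘ a′ → b ≡ₘ b′ → a + b ≡ₘ a′ + b′
  +-congₘ {a} {a′} {b} {b′} a≡a′ b≡b′ = begin
    a + b               ≈⟨ %-distribˡ-+ a b e ⟩
    a % e + b % e       ≡⟨ ≡.cong₂ _+_ a≡a′ b≡b′ ⟩
    a′ % e + b′ % e     ≈⟨ %-distribˡ-+ a′ b′ e ⟨
    a′ + b′             ∎

  *-congₘ : ∀ {a a′ b b′} → a ≡ₘ a′ → b ≡ₘ b′ → a * b ≡ₘ a′ * b′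
  *-congₘ {a} {a′} {b} {b′} a≡a′ b≡b′ = begin
    a * b               ≈⟨ %-distribˡ-* a b e ⟩
    a % e * (b % e)     ≡⟨ ≡.cong₂ _*_ a≡a′ b≡b′ ⟩
    a′ % e * (b′ % e)   ≈⟨ %-distribˡ-* a′ b′ e ⟨
    a′ * b′             ∎

  e≡ₘ0 : e ≡ₘ 0
  e≡ₘ0 = ≡.trans (n%n≡0 e) (≡.sym (m*n%n≡0 0 e))

  -- k % e ≤ e, so the truncated subtraction really is e − (k mod e).
  neg : ℕ → ℕ
  neg k = e ∸ k % e

  neg-cong : ∀ {m n} → m ≡ₘ n → neg m ≡ neg n
  neg-cong = ≡.cong (e ∸_)

  neg-inverseˡ : ∀ k → neg k + k ≡ₘ 0
  neg-inverseˡ k = begin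
    e ∸ k % e + k       ≈⟨ +-congₘ refl (%-≡ₘ k) ⟨
    e ∸ k % e + k % e   ≡⟨ m∸n+n≡m (m%n≤n k e) ⟩
    e                   ≈⟨ e≡ₘ0 ⟩
    0                   ∎

  neg-inverseʳ : ∀ k → k + neg k ≡ₘ 0
  neg-inverseʳ k = trans (reflexive (+-comm k (neg k))) (neg-inverseˡ k)

  *-neg-cancel : ∀ x y → x * neg y + x * y ≡ₘ 0
  *-neg-cancel x y = begin
    x * neg y + x * y   ≡⟨ *-distribˡ-+ x (neg y) y ⟨
    x * (neg y + y)     ≈⟨ *-congₘ {x} refl (neg-inverseˡ y) ⟩
    x * 0               ≡⟨ *-zeroʳ x ⟩
    0                   ∎

  toℕ-mod : ∀ m → toℕ (m mod e) ≡ m % e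
  toℕ-mod m = toℕ-fromℕ< (m%n<n m e)

  toℕ-mod-≡ₘ : ∀ m → toℕ (m mod e) ≡ₘ m
  toℕ-mod-≡ₘ m = trans (reflexive (toℕ-mod m)) (%-≡ₘ m)

  mod-cong : ∀ {m n} → m ≡ₘ n → m mod e ≡ n mod e
  mod-cong {m} {n} m≡n = toℕ-injective (≡.trans (toℕ-mod m) (≡.trans m≡n (≡.sym (toℕ-mod n))))

  toℕ-mod-inverse : ∀ (u : Fin e) → toℕ u mod e ≡ u
  toℕ-mod-inverse u = toℕ-injective (≡.trans (toℕ-mod (toℕ u)) (m<n⇒m%n≡m (toℕ<n u)))

  rotate : ℕ → Fin e → Fin e
  rotate k u = (k + toℕ u) mod e

  rotate-inverse : ∀ {a b} → a + b ≡ₘ 0 → ∀ u → rotate a (rotate b u) ≡ u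
  rotate-inverse {a} {b} a+b≡0 u = ≡.trans (mod-cong (begin
    a + toℕ (rotate b u)   ≈⟨ +-congₘ {a} refl (toℕ-mod-≡ₘ (b + toℕ u)) ⟩
    a + (b + toℕ u)        ≡⟨ +-assoc a b (toℕ u) ⟨
    a + b + toℕ u          ≈⟨ +-congₘ a+b≡0 refl ⟩
    toℕ u                  ∎)) (toℕ-mod-inverse u)

  rotation : ℕ → Permutation e e
  rotation k = permutation (rotate k) (rotate (neg k))
    (rotate-inverse (neg-inverseʳ k)) (rotate-inverse (neg-inverseˡ k))

  shift : Fin e → Fin e → Fin e → Fin e
  shift d s = rotate (toℕ d * toℕ s)

  shift-permutation : Fin e → Fin e → Permutation e e
  shift-permutation d s = rotation (toℕ d * toℕ s)

  record Compatible (d d₁ d₂ : Fin e) : Set where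
    constructor compatible
    field d₂*d+d₁≡0 : toℕ d₂ * toℕ d + toℕ d₁ ≡ₘ 0

  shift-absorb : ∀ {d d₁ d₂} → Compatible d d₁ d₂ →
                 ∀ s u i → shift d₂ (shift d s u) (shift d₁ s i) ≡ shift d₂ u i
  shift-absorb {d} {d₁} {d₂} (compatible d₂*d+d₁≡0) s u i = mod-cong (begin
    toℕ d₂ * toℕ (shift d s u) + toℕ (shift d₁ s i)
      ≈⟨ +-congₘ (*-congₘ {toℕ d₂} refl (toℕ-mod-≡ₘ _)) (toℕ-mod-≡ₘ _) ⟩
    toℕ d₂ * (toℕ d * toℕ s + toℕ u) + (toℕ d₁ * toℕ s + toℕ i)
      ≡⟨ regroup (toℕ d) (toℕ d₁) (toℕ d₂) (toℕ s) (toℕ u) (toℕ i) ⟩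
    (toℕ d₂ * toℕ d + toℕ d₁) * toℕ s + (toℕ d₂ * toℕ u + toℕ i)
      ≈⟨ +-congₘ (*-congₘ {b = toℕ s} d₂*d+d₁≡0 refl) refl ⟩
    toℕ d₂ * toℕ u + toℕ i
      ∎)
    where
    regroup : ∀ d d₁ d₂ s u i → d₂ * (d * s + u) + (d₁ * s + i) ≡ (d₂ * d + d₁) * s + (d₂ * u + i)
    regroup = solve-∀

  toℕ-mulZ : ∀ a b → toℕ (mulZ e a b) ≡ₘ toℕ a * toℕ b
  toℕ-mulZ a b = toℕ-mod-≡ₘ (toℕ a * toℕ b)

  toℕ-negZ : ∀ a → toℕ (negZ e a) ≡ₘ neg (toℕ a)
  toℕ-negZ a = begin
    toℕ (negZ e a)     ≈⟨ toℕ-mod-≡ₘ (e ∸ toℕ a) ⟩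
    e ∸ toℕ a          ≡⟨ ≡.cong (e ∸_) (m<n⇒m%n≡m (toℕ<n a)) ⟨
    neg (toℕ a)        ∎

  toℕ-val*inv : ∀ (d : UnitZ e) → toℕ (UnitZ.val d) * toℕ (UnitZ.inv d) ≡ₘ 1
  toℕ-val*inv (unitZ a a⁻¹ a*a⁻¹≡1) = begin
    toℕ a * toℕ a⁻¹    ≈⟨ toℕ-mulZ a a⁻¹ ⟨
    toℕ (mulZ e a a⁻¹) ≡⟨ ≡.cong toℕ a*a⁻¹≡1 ⟩
    toℕ (oneZ e)       ≈⟨ toℕ-mod-≡ₘ 1 ⟩
    1                  ∎

  negZ-inv-compatible : ∀ (d₁ d₂ : UnitZ e) →
    Compatible (negZ e (mulZ e (UnitZ.inv d₂) (UnitZ.val d₁))) (UnitZ.val d₁) (UnitZ.val d₂)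
  negZ-inv-compatible (unitZ c _ _) d₂@(unitZ a b _) = compatible (begin
    toℕ a * toℕ (negZ e (mulZ e b c)) + toℕ c
      ≈⟨ +-congₘ (*-congₘ {toℕ a} refl negZ-bc) c≡abc ⟩
    toℕ a * neg (toℕ b * toℕ c) + toℕ a * (toℕ b * toℕ c)
      ≈⟨ *-neg-cancel (toℕ a) (toℕ b * toℕ c) ⟩
    0 ∎)
    where
    negZ-bc : toℕ (negZ e (mulZ e b c)) ≡ₘ neg (toℕ b * toℕ c)
    negZ-bc = trans (toℕ-negZ (mulZ e b c)) (reflexive (neg-cong (toℕ-mulZ b c)))

    c≡abc : toℕ c ≡ₘ toℕ a * (toℕ b * toℕ c)
    c≡abc = begin
      toℕ c                     ≡⟨ *-identityˡ (toℕ c) ⟨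
      1 * toℕ c                 ≈⟨ *-congₘ {b = toℕ c} (toℕ-val*inv d₂) refl ⟨
      toℕ a * toℕ b * toℕ c     ≡⟨ *-assoc (toℕ a) (toℕ b) (toℕ c) ⟩
      toℕ a * (toℕ b * toℕ c)   ∎

  minusOne-compatible : ∀ d → Compatible d d (minusOneZ e)
  minusOne-compatible d = compatible (begin
    toℕ (minusOneZ e) * toℕ d + toℕ d
      ≈⟨ +-congₘ (*-congₘ {b = toℕ d} toℕ-minusOne refl) refl ⟩
    neg 1 * toℕ d + toℕ d
      ≡⟨ ≡.cong₂ _+_ (*-comm (toℕ d) (neg 1)) (*-identityʳ (toℕ d)) ⟨
    toℕ d * neg 1 + toℕ d * 1
      ≈⟨ *-neg-cancel (toℕ d) 1 ⟩
    0 ∎)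
    where
    toℕ-minusOne : toℕ (minusOneZ e) ≡ₘ neg 1
    toℕ-minusOne = trans (toℕ-negZ (oneZ e)) (reflexive (neg-cong (toℕ-mod-≡ₘ 1)))

module DoubleSum {c ℓ} (R : Semiring c ℓ) where

  open Semiring R
  open SemiringSum R using (sum; sum-cong-≋; ∑-comm; ∑-permute; *-distribˡ-sum; *-distribʳ-sum)
  open SetoidReasoning setoid

  ∑₂ : ∀ {m n} → (Fin m → Fin n → Carrier) → Carrier
  ∑₂ f = sum λ s → sum λ t → f s t

  ∑₂-cong : ∀ {m n} {f g : Fin m → Fin n → Carrier} → (∀ s t → f s t ≈ g s t) → ∑₂ f ≈ ∑₂ g
  ∑₂-cong f≈g = sum-cong-≋ λ s → sum-cong-≋ (f≈g s)

  *-distribˡ-∑₂ : ∀ {m n} x (f : Fin m → Fin n → Carrier) → x * ∑₂ f ≈ ∑₂ λ s t → x * f s t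
  *-distribˡ-∑₂ x f =
    trans (*-distribˡ-sum x (λ s → sum (f s))) (sum-cong-≋ λ s → *-distribˡ-sum x (f s))

  *-distribʳ-∑₂ : ∀ {m n} x (f : Fin m → Fin n → Carrier) → ∑₂ f * x ≈ ∑₂ λ s t → f s t * x
  *-distribʳ-∑₂ x f =
    trans (*-distribʳ-sum x (λ s → sum (f s))) (sum-cong-≋ λ s → *-distribʳ-sum x (f s))

  ∑₂-permute : ∀ {m n} (f : Fin m → Fin n → Carrier) (π : Permutation m m) (ρ : Permutation n n) →
               ∑₂ f ≈ ∑₂ λ s t → f (π ⟨$⟩ʳ s) (ρ ⟨$⟩ʳ t)
  ∑₂-permute f π ρ = trans (∑-permute _ π) (sum-cong-≋ λ s → ∑-permute (f (π ⟨$⟩ʳ s)) ρ)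

  ∑₂-comm : ∀ {m n p q} (F : Fin m → Fin n → Fin p → Fin q → Carrier) →
            ∑₂ (λ s t → ∑₂ (F s t)) ≈ ∑₂ λ u v → ∑₂ λ s t → F s t u v
  ∑₂-comm F = begin
    ∑₂ (λ s t → ∑₂ (F s t))
      ≈⟨ sum-cong-≋ (λ s → ∑-comm λ t u → sum (F s t u)) ⟩
    sum (λ s → sum λ u → sum λ t → sum λ v → F s t u v)
      ≈⟨ ∑-comm (λ s u → sum λ t → sum λ v → F s t u v) ⟩
    sum (λ u → sum λ s → sum λ t → sum λ v → F s t u v)
      ≈⟨ sum-cong-≋ (λ u → sum-cong-≋ λ s → ∑-comm λ t v → F s t u v) ⟩
    sum (λ u → sum λ s → sum λ v → sum λ t → F s t u v)
      ≈⟨ sum-cong-≋ (λ u → ∑-comm λ s v → sum λ t → F s t u v) ⟩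
    ∑₂ (λ u v → ∑₂ λ s t → F s t u v)
      ∎

module _ {c ℓ} (K : Field c ℓ) {e : ℕ} .{{_ : NonZero e}} where

  open Field K
  open ModularArithmetic e using (shift; shift-permutation; Compatible; shift-absorb)
  open DoubleSum semiring
  open SetoidReasoning setoid

  compose-assoc : ∀ (A B C : Mat K e) {d d₁ d₂ : ZMod e} → Compatible d d₁ d₂ →
                  _≋_ K (compose K A d₁ (compose K B d₂ C)) (compose K (compose K A d B) d₂ C)
  compose-assoc A B C {d} {d₁} {d₂} compat i j = begin
    ∑₂ (λ s t → A s t * ∑₂ λ u v → B u v * C (shift d₂ u (shift d₁ s i)) (shift d₂ v (shift d₁ t j)))
      ≈⟨ ∑₂-cong (λ s t → *-distribˡ-∑₂ {e} {e} (A s t) _) ⟩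
    ∑₂ (λ s t → ∑₂ (summand s t))
      ≈⟨ ∑₂-cong (λ s t → ∑₂-permute (summand s t) (shift-permutation d s) (shift-permutation d t)) ⟩
    ∑₂ (λ s t → ∑₂ λ u v → A s t * (B (shift d s u) (shift d t v)
                                    * C (shift d₂ (shift d s u) (shift d₁ s i)) (shift d₂ (shift d t v) (shift d₁ t j))))
      ≈⟨ ∑₂-cong (λ s t → ∑₂-cong λ u v → trans (sym (*-assoc _ _ _))
           (*-congˡ (reflexive (≡.cong₂ C (shift-absorb compat s u i) (shift-absorb compat t v j))))) ⟩
    ∑₂ (λ s t → ∑₂ λ u v → A s t * B (shift d s u) (shift d t v) * C (shift d₂ u i) (shift d₂ v j))
      ≈⟨ ∑₂-comm {e} {e} {e} {e} _ ⟩
    ∑₂ (λ u v → ∑₂ λ s t → A s t * B (shift d s u) (shift d t v) * C (shift d₂ u i) (shift d₂ v j))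
      ≈⟨ ∑₂-cong (λ u v → *-distribʳ-∑₂ {e} {e} (C (shift d₂ u i) (shift d₂ v j)) _) ⟨
    ∑₂ (λ u v → ∑₂ (λ s t → A s t * B (shift d s u) (shift d t v)) * C (shift d₂ u i) (shift d₂ v j))
      ∎
    where
    summand : Fin e → Fin e → Fin e → Fin e → Carrier
    summand s t u v = A s t * (B u v * C (shift d₂ u (shift d₁ s i)) (shift d₂ v (shift d₁ t j)))

open ModularArithmetic using (negZ-inv-compatible; minusOne-compatible)

proposition3p4 : ∀ {c ℓ} (K : Field c ℓ) → CharZero K →
  (e : ℕ) .{{_ : NonZero e}} → 2 ≤ e →
  (∀ (A B C : Mat K e) (d₁ d₂ : UnitZ e) →
    _≋_ K (compose K A (UnitZ.val d₁) (compose K B (UnitZ.val d₂) C))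
          (compose K (compose K A (negZ e (mulZ e (UnitZ.inv d₂) (UnitZ.val d₁))) B)
                     (UnitZ.val d₂) C))
  × (∀ (A B C : Mat K e) (d₁ : UnitZ e) →
    _≋_ K (compose K A (UnitZ.val d₁) (compose K B (minusOneZ e) C))
          (compose K (compose K A (UnitZ.val d₁) B) (minusOneZ e) C))
  × (∀ (A B C : Mat K e) →
    _≋_ K (compose K A (minusOneZ e) (compose K B (minusOneZ e) C))
          (compose K (compose K A (minusOneZ e) B) (minusOneZ e) C))
proposition3p4 K _ e _ =
  (λ A B C d₁ d₂ → compose-assoc K A B C (negZ-inv-compatible e d₁ d₂)) ,
  (λ A B C d₁ → compose-assoc K A B C (minusOne-compatible e (UnitZ.val d₁))) ,
  (λ A B C → compose-assoc K A B C (minusOne-compatible e (minusOneZ e)))
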